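{- If $G$ is a connected critical graph, then $G$ has a unique independence packing, namely the collection consisting of $G$ itself.
   Context: Graphs are finite, simple, undirected; $\alpha$ = independence number. An edge $e$ is critical if $\alpha(G-e)>\alpha(G)$; a graph is critical if all its edges are critical. An independence packing of $G$ is a collection of vertex-disjoint subgraphs $G_1,\dots,G_k$ of $G$ such that each $G_i$ is connected and critical, $V(G)=\bigcup_{i=1}^k V(G_i)$, and $\alpha(G)=\sum_{i=1}^k\alpha(G_i)$. -}

module Defs where

open import Data.Nat using (ℕ; _≤_; _<_)
open import Data.Bool using (Bool; true; false; _∧_; _∨_; not)
open import Data.Fin using (Fin; _≟_)
open import Data.Fin.Subset using (Subset; _∈_; _⊆_; ∣_∣; ⊤)
open import Data.Vec using (sum; tabulate)
open import Data.Product using (Σ; ∃; _×_; _,_)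
open import Relation.Nullary using (¬_)
open import Relation.Nullary.Decidable using (⌊_⌋)
open import Relation.Binary.PropositionalEquality using (_≡_; _≢_)

record Graph (n : ℕ) : Set where
  field
    verts  : Subset n
    adj    : Fin n → Fin n → Bool
    sym    : ∀ u v → adj u v ≡ adj v u
    irrefl : ∀ u → adj u u ≡ false
    closed : ∀ u v → adj u v ≡ true → u ∈ verts
open Graph public

record _≤G_ {n : ℕ} (H G : Graph n) : Set where
  field
    verts⊆ : verts H ⊆ verts G
    adj⊆   : ∀ u v → adj H u v ≡ true → adj G u v ≡ true
open _≤G_ public

Independent : {n : ℕ} → Subset n → (Fin n → Fin n → Bool) → Subset n → Set
Independent S A T = T ⊆ S × (∀ u v → u ∈ T → v ∈ T → A u v ≡ false)

IsAlpha : {n : ℕ} → Subset n → (Fin n → Fin n → Bool) → ℕ → Set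
IsAlpha S A k =
  (∃ λ T → Independent S A T × ∣ T ∣ ≡ k) ×
  (∀ T → Independent S A T → ∣ T ∣ ≤ k)

α≡ : {n : ℕ} → Graph n → ℕ → Set
α≡ G k = IsAlpha (verts G) (adj G) k

deleteEdge : {n : ℕ} → (Fin n → Fin n → Bool) → Fin n → Fin n → Fin n → Fin n → Bool
deleteEdge A a b u v =
  A u v ∧ not ((⌊ u ≟ a ⌋ ∧ ⌊ v ≟ b ⌋) ∨ (⌊ u ≟ b ⌋ ∧ ⌊ v ≟ a ⌋))

CriticalEdge : {n : ℕ} → Graph n → Fin n → Fin n → Set
CriticalEdge G a b = ∀ k k′ → α≡ G k →
  IsAlpha (verts G) (deleteEdge (adj G) a b) k′ → k < k′

Critical : {n : ℕ} → Graph n → Set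
Critical G = ∀ a b → adj G a b ≡ true → CriticalEdge G a b

data Walk {n : ℕ} (A : Fin n → Fin n → Bool) : Fin n → Fin n → Set where
  here : ∀ {u} → Walk A u u
  step : ∀ {u w v} → A u w ≡ true → Walk A w v → Walk A u v

Connected : {n : ℕ} → Graph n → Set
Connected G = (∃ λ v → v ∈ verts G) ×
  (∀ u v → u ∈ verts G → v ∈ verts G → Walk (adj G) u v)

record IndependencePacking {n : ℕ} (G : Graph n) : Set where
  field
    k         : ℕ
    part      : Fin k → Graph n
    isSub     : ∀ i → part i ≤G G
    connected : ∀ i → Connected (part i)
    critical  : ∀ i → Critical (part i)
    disjoint  : ∀ i j → i ≢ j → ∀ v → v ∈ verts (part i) → ¬ (v ∈ verts (part j))
    covers    : ∀ v → v ∈ verts G → ∃ λ i → v ∈ verts (part i)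
    αsum      : ∀ a (as : Fin k → ℕ) → α≡ G a → (∀ i → α≡ (part i) (as i)) →
                a ≡ sum (tabulate as)
open IndependencePacking public

SameGraph : {n : ℕ} → Graph n → Graph n → Set
SameGraph H G = verts H ≡ verts G × (∀ u v → adj H u v ≡ adj G u v)

IsTrivialPacking : {n : ℕ} {G : Graph n} → IndependencePacking G → Set
IsTrivialPacking {G = G} P = k P ≡ 1 × (∀ i → SameGraph (part P i) G)

-- If an edge e of G lay in no member of an independence packing, every member
-- would be a subgraph of G - e; restricting a maximum independent set of G - e
-- to the members then gives α(G - e) ≤ Σ α(Gᵢ) = α(G), contradicting the
-- criticality of e.  So each edge of G lies inside a member.  As the members are
-- vertex-disjoint, each member's vertex set is closed under the edges of G, and
-- connectivity forces every member to contain all of V(G): there is just one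
-- member, and it has all vertices and all edges of G.
module Submission where

open import Defs
open import Data.Nat using (ℕ; zero; suc; _+_; _≤_; z≤n; s≤s)
open import Data.Nat.Properties
  using (≤-antisym; ≤-trans; ≤-reflexive; ≤∧≢⇒<; m<1+n⇒m≤n; ≤⇒≯; +-suc; m≤n⇒m≤1+n;
         +-mono-≤; +-monoʳ-≤; +-identityʳ)
  renaming (_≟_ to _≟ℕ_)
open import Data.Bool using (Bool; true; false; not)
open import Data.Bool.Properties using (⇔→≡; ¬-not; not-¬) renaming (_≟_ to _≟𝔹_)
open import Data.Fin using (Fin; zero; suc; _≟_)
open import Data.Fin.Properties using (any?; all?)
open import Data.Fin.Subset using (Subset; Empty; _∈_; _∉_; ∣_∣; _∩_; _─_; inside; outside; ⊥)
open import Data.Fin.Subset.Properties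
  using (_⊆?_; _∈?_; anySubset?; ∣p∣≤n; ∉⊥; ∣⊥∣≡0; Empty-unique; x∈p∩q⁺; x∈p∩q⁻;
         p─q⊆p; ⊆-antisym)
open import Data.Vec using ([]; _∷_; here; there; sum; tabulate)
open import Data.Product using (Σ; _×_; ∃; _,_; proj₁; proj₂)
open import Data.Sum using (_⊎_; inj₁; inj₂)
open import Data.Empty using (⊥-elim)
open import Function.Bundles using (mk⇔)
open import Relation.Nullary using (¬_; Irrelevant; yes; no; contradiction)
open import Relation.Nullary.Decidable using (_×-dec_; _⊎-dec_; _→-dec_; dec-false; isYes≗does; decidable-stable)
open import Relation.Unary using (Pred; Decidable)
open import Relation.Binary.PropositionalEquality
  using (_≡_; refl; trans; cong; subst) renaming (sym to ≡-sym)

bounded-maximum : ∀ {p} {P : Pred ℕ p} → Decidable P → P 0 → ∀ b → (∀ {m} → P m → m ≤ b) →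
  ∃ λ k → P k × (∀ {m} → P m → m ≤ k)
bounded-maximum P? p₀ zero    ≤b = 0 , p₀ , ≤b
bounded-maximum P? p₀ (suc b) ≤b with P? (suc b)
... | yes p = suc b , p , ≤b
... | no ¬p = bounded-maximum P? p₀ b λ {m} pm →
  m<1+n⇒m≤n (≤∧≢⇒< (≤b pm) λ { refl → ¬p pm })

independent? : ∀ {n} (S : Subset n) A → Decidable (Independent S A)
independent? S A T = (T ⊆? S) ×-dec all? λ u → all? λ v →
  (u ∈? T) →-dec (v ∈? T) →-dec (A u v ≟𝔹 false)

α-exists : ∀ {n} (S : Subset n) A → ∃ (IsAlpha S A)
α-exists {n} S A =
  let k , witness , maximal = bounded-maximum hasIndependentOfSize? (⊥ , ∅-independent , ∣⊥∣≡0 n) n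
                                λ { (T , _ , refl) → ∣p∣≤n T }
  in k , witness , λ T T-indep → maximal (T , T-indep , refl)
  where
  hasIndependentOfSize? : Decidable λ m → ∃ λ T → Independent S A T × ∣ T ∣ ≡ m
  hasIndependentOfSize? m = anySubset? λ T → independent? S A T ×-dec (∣ T ∣ ≟ℕ m)
  ∅-independent : Independent S A ⊥
  ∅-independent = (λ x∈∅ → ⊥-elim (∉⊥ x∈∅)) , λ _ _ u∈∅ _ → ⊥-elim (∉⊥ u∈∅)

α : ∀ {n} → Subset n → (Fin n → Fin n → Bool) → ℕ
α S A = proj₁ (α-exists S A)

α-isAlpha : ∀ {n} (S : Subset n) A → IsAlpha S A (α S A)
α-isAlpha S A = proj₂ (α-exists S A)

α-unique : ∀ {n} {S : Subset n} {A a b} → IsAlpha S A a → IsAlpha S A b → a ≡ b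
α-unique ((T , T-indep , refl) , a-max) ((T′ , T′-indep , refl) , b-max) =
  ≤-antisym (b-max T T-indep) (a-max T′ T′-indep)

∣p∣≤∣q∣+∣p─q∣ : ∀ {n} (p q : Subset n) → ∣ p ∣ ≤ ∣ q ∣ + ∣ p ─ q ∣
∣p∣≤∣q∣+∣p─q∣ []            []            = z≤n
∣p∣≤∣q∣+∣p─q∣ (inside  ∷ p) (inside  ∷ q) = s≤s (∣p∣≤∣q∣+∣p─q∣ p q)
∣p∣≤∣q∣+∣p─q∣ (outside ∷ p) (inside  ∷ q) = m≤n⇒m≤1+n (∣p∣≤∣q∣+∣p─q∣ p q)
∣p∣≤∣q∣+∣p─q∣ (inside  ∷ p) (outside ∷ q) =
  ≤-trans (s≤s (∣p∣≤∣q∣+∣p─q∣ p q)) (≤-reflexive (≡-sym (+-suc ∣ q ∣ ∣ p ─ q ∣)))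
∣p∣≤∣q∣+∣p─q∣ (outside ∷ p) (outside ∷ q) = ∣p∣≤∣q∣+∣p─q∣ p q

x∈p─q⇒x∉q : ∀ {n} {x : Fin n} (p q : Subset n) → x ∈ p ─ q → x ∉ q
x∈p─q⇒x∉q (inside ∷ p) (outside ∷ q) here      ()
x∈p─q⇒x∉q (s ∷ p)      (t ∷ q)       (there x) (there y) = x∈p─q⇒x∉q p q x y

∣∣≤sum-of-cover : ∀ {n k} (T : Subset n) (U : Fin k → Subset n) →
  (∀ {x} → x ∈ T → ∃ λ i → x ∈ U i) → ∣ T ∣ ≤ sum (tabulate λ i → ∣ U i ∣)
∣∣≤sum-of-cover {n} {zero} T U cover =
  ≤-reflexive (trans (cong ∣_∣ (Empty-unique T-empty)) (∣⊥∣≡0 n))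
  where
  T-empty : Empty T
  T-empty (_ , x∈T) with cover x∈T
  ... | () , _
∣∣≤sum-of-cover {k = suc k} T U cover =
  ≤-trans (∣p∣≤∣q∣+∣p─q∣ T (U zero))
          (+-monoʳ-≤ ∣ U zero ∣ (∣∣≤sum-of-cover (T ─ U zero) (λ i → U (suc i)) cover′))
  where
  cover′ : ∀ {x} → x ∈ T ─ U zero → ∃ λ i → x ∈ U (suc i)
  cover′ x∈T─U₀ with cover (p─q⊆p T (U zero) x∈T─U₀)
  ... | zero  , x∈U₀ = ⊥-elim (x∈p─q⇒x∉q T (U zero) x∈T─U₀ x∈U₀)
  ... | suc i , x∈Uᵢ = i , x∈Uᵢ

sum-tabulate-mono : ∀ {k} {f g : Fin k → ℕ} → (∀ i → f i ≤ g i) →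
  sum (tabulate f) ≤ sum (tabulate g)
sum-tabulate-mono {zero}  f≤g = z≤n
sum-tabulate-mono {suc k} f≤g = +-mono-≤ (f≤g zero) (sum-tabulate-mono λ i → f≤g (suc i))

Independent-∩ : ∀ {n} {S S′ : Subset n} {A B T} → (∀ {u v} → B u v ≡ true → A u v ≡ true) →
  Independent S A T → Independent S′ B (T ∩ S′)
Independent-∩ {S′ = S′} {T = T} B⊆A (_ , T-indep) =
  (λ x∈T∩S′ → proj₂ (x∈p∩q⁻ T S′ x∈T∩S′)) ,
  λ u v u∈ v∈ → ¬-not λ Buv →
    not-¬ (B⊆A Buv) (T-indep u v (proj₁ (x∈p∩q⁻ T S′ u∈)) (proj₁ (x∈p∩q⁻ T S′ v∈)))

α≤sum-of-cover : ∀ {n k} {S : Subset n} {A} (H : Fin k → Graph n) →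
  (∀ {x} → x ∈ S → ∃ λ i → x ∈ verts (H i)) →
  (∀ i {u v} → adj (H i) u v ≡ true → A u v ≡ true) →
  ∀ {a} {αs : Fin k → ℕ} → IsAlpha S A a → (∀ i → α≡ (H i) (αs i)) → a ≤ sum (tabulate αs)
α≤sum-of-cover H cover H⊆A ((T , T-indep , refl) , _) αH =
  ≤-trans (∣∣≤sum-of-cover T (λ i → T ∩ verts (H i)) cover-T)
          (sum-tabulate-mono λ i → proj₂ (αH i) _ (Independent-∩ (H⊆A i) T-indep))
  where
  cover-T : ∀ {x} → x ∈ T → ∃ λ i → x ∈ T ∩ verts (H i)
  cover-T x∈T with cover (proj₁ T-indep x∈T)
  ... | i , x∈Hᵢ = i , x∈p∩q⁺ (x∈T , x∈Hᵢ)

deleteEdge-keeps : ∀ {n} (A : Fin n → Fin n → Bool) {a b u v} → A u v ≡ true →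
  ¬ ((u ≡ a × v ≡ b) ⊎ (u ≡ b × v ≡ a)) → deleteEdge A a b u v ≡ true
-- ⌊_⌋ is isYes, not does; turned into does, the four tests are one Dec of the disjunction.
deleteEdge-keeps A {a} {b} {u} {v} Auv uv≢ab
  rewrite Auv | isYes≗does (u ≟ a) | isYes≗does (v ≟ b) | isYes≗does (u ≟ b) | isYes≗does (v ≟ a)
  = cong not (dec-false (((u ≟ a) ×-dec (v ≟ b)) ⊎-dec ((u ≟ b) ×-dec (v ≟ a))) uv≢ab)

closed-under-walks : ∀ {n} {A : Fin n → Fin n → Bool} {W : Subset n} →
  (∀ {u v} → A u v ≡ true → u ∈ W → v ∈ W) → ∀ {u v} → Walk A u v → u ∈ W → v ∈ W
closed-under-walks closed here         u∈W = u∈W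
closed-under-walks closed (step e walk) u∈W = closed-under-walks closed walk (closed e u∈W)

Fin-irrelevant⇒≡1 : ∀ {m} → Fin m → Irrelevant (Fin m) → m ≡ 1
Fin-irrelevant⇒≡1 {suc zero}    _ _   = refl
Fin-irrelevant⇒≡1 {suc (suc m)} _ irr with irr zero (suc zero)
... | ()

module _ {n} {G : Graph n} (crit : Critical G) (P : IndependencePacking G) where

  edge-in-part : ∀ {a b} → adj G a b ≡ true → ∃ λ i → adj (part P i) a b ≡ true
  edge-in-part {a} {b} Gab with any? (λ i → adj (part P i) a b ≟𝔹 true)
  ... | yes found = found
  ... | no ¬found =
    contradiction (crit a b Gab _ _ (α-isAlpha _ _) (α-isAlpha _ _)) (≤⇒≯ α[G−ab]≤α[G])
    where
    part⊆G−ab : ∀ i {u v} → adj (part P i) u v ≡ true → deleteEdge (adj G) a b u v ≡ true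
    part⊆G−ab i Huv = deleteEdge-keeps (adj G) (adj⊆ (isSub P i) _ _ Huv) λ
      { (inj₁ (refl , refl)) → ¬found (i , Huv)
      ; (inj₂ (refl , refl)) → ¬found (i , trans (Graph.sym (part P i) a b) Huv) }
    αparts : ∀ i → α≡ (part P i) (α (verts (part P i)) (adj (part P i)))
    αparts i = α-isAlpha _ _
    α[G−ab]≤α[G] : α (verts G) (deleteEdge (adj G) a b) ≤ α (verts G) (adj G)
    α[G−ab]≤α[G] = subst (_ ≤_) (≡-sym (αsum P _ _ (α-isAlpha _ _) αparts))
      (α≤sum-of-cover (part P) (covers P _) part⊆G−ab (α-isAlpha _ _) αparts)

  part-closed-under-edges : ∀ j {u v} → adj G u v ≡ true →
    u ∈ verts (part P j) → v ∈ verts (part P j)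
  part-closed-under-edges j {u} {v} Guv u∈Gⱼ with edge-in-part Guv
  ... | i , Gᵢuv with i ≟ j
  ...   | yes refl = closed (part P i) v u (trans (Graph.sym (part P i) v u) Gᵢuv)
  ...   | no i≢j   = ⊥-elim (disjoint P i j i≢j u (closed (part P i) u v Gᵢuv) u∈Gⱼ)

  module _ (conn : Connected G) where

    part-spans : ∀ j {u} → u ∈ verts G → u ∈ verts (part P j)
    part-spans j u∈G with connected P j
    ... | (x , x∈Gⱼ) , _ =
      closed-under-walks (part-closed-under-edges j)
                         (proj₂ conn x _ (verts⊆ (isSub P j) x∈Gⱼ) u∈G) x∈Gⱼ

    parts-irrelevant : Irrelevant (Fin (k P))
    parts-irrelevant i j = decidable-stable (i ≟ j) λ i≢j →
      let x , x∈G = proj₁ conn in disjoint P i j i≢j x (part-spans i x∈G) (part-spans j x∈G)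

    part-same-as-G : ∀ i → SameGraph (part P i) G
    part-same-as-G i = ⊆-antisym (verts⊆ (isSub P i)) (part-spans i) , λ u v →
      ⇔→≡ (mk⇔ (adj⊆ (isSub P i) u v) λ Guv →
        let j , Gⱼuv = edge-in-part Guv
        in subst (λ j → adj (part P j) u v ≡ true) (parts-irrelevant j i) Gⱼuv)

    packing-trivial : IsTrivialPacking P
    packing-trivial =
      Fin-irrelevant⇒≡1 (proj₁ (covers P _ (proj₂ (proj₁ conn)))) parts-irrelevant , part-same-as-G

trivialPacking : ∀ {n} (G : Graph n) → Connected G → Critical G → IndependencePacking G
trivialPacking G conn crit = record
  { k         = 1
  ; part      = λ _ → G
  ; isSub     = λ _ → record { verts⊆ = λ v∈G → v∈G ; adj⊆ = λ _ _ Guv → Guv }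
  ; connected = λ _ → conn
  ; critical  = λ _ → crit
  ; disjoint  = λ { zero zero 0≢0 → contradiction refl 0≢0 }
  ; covers    = λ _ v∈G → zero , v∈G
  ; αsum      = λ _ _ αG αparts → trans (α-unique αG (αparts zero)) (≡-sym (+-identityʳ _))
  }

lemma4p2 : ∀ {n : ℕ} (G : Graph n) → Connected G → Critical G →
    Σ (IndependencePacking G) IsTrivialPacking × ((P : IndependencePacking G) → IsTrivialPacking P)
lemma4p2 G conn crit =
  (trivialPacking G conn crit , refl , λ _ → refl , λ _ _ → refl) ,
  λ P → packing-trivial crit P conn
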